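{- For any constant $\varepsilon>0$, any integer $k\ge1$ and any undirected graph $G=(V,E,w)$ with positive edge weights, the output $\mathcal{M}=\{M_1,\dots,M_k\}$ of Algorithm STK (described in the context) on $G,k,\varepsilon$ is a $k$-disjoint matching satisfying $$w(\mathcal{M})\ \ge\ \frac{1}{3+2\varepsilon}\,w(\mathcal{M}^\ast),$$ where $\mathcal{M}^\ast$ is a $k$-disjoint matching of $G$ of maximum weight; i.e., $\mathcal{M}$ is a $\frac{1}{3+2\varepsilon}$-approximate solution to the $k$-DM problem.
   Context: A $k$-disjoint matching in $G$ is a collection $\mathcal{M}=\{M_1,\dots,M_k\}$ of matchings of $G$ that are pairwise edge-disjoint; its weight is $w(\mathcal{M})=\sum_{i=1}^k\sum_{e\in M_i}w(e)$. The $k$-DM problem asks for a $k$-disjoint matching of maximum weight. $[t]$ denotes $\{1,\dots,t\}$. Algorithm STK (input: the edges of $E$ presented one at a time in an arbitrary order, an integer $k$, and $\varepsilon>0$): Initialization: set $\phi(c,v)=0$ for all $c\in[k]$, $v\in V$; create $k$ empty stacks $S(1),\dots,S(k)$. Streaming phase: for each arriving edge $e=(u,v)$, for $c=1,2,\dots,k$ in order: let $\phi_c=\phi(c,u)+\phi(c,v)$; if $w(e)\ge(1+\varepsilon)\phi_c$, then set $w'(c,e)=w(e)-\phi_c$, increase both $\phi(c,u)$ and $\phi(c,v)$ by $w'(c,e)$, push $e$ onto $S(c)$, and stop processing $e$. If no $c$ satisfies the condition, $e$ is discarded. Post-processing: set $M_c=\emptyset$ for all $c\in[k]$. For $c=1,\dots,k$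 in increasing order: while $S(c)$ is nonempty, pop the top edge $e=(u,v)$ of $S(c)$; if neither $u$ nor $v$ is an endpoint of an edge in $M_c$, add $e$ to $M_c$; otherwise, for $j=c+1,\dots,k$ in order: let $\phi_j=\phi(j,u)+\phi(j,v)$; if $w(e)\ge(1+\varepsilon)\phi_j$, set $w'(j,e)=w(e)-\phi_j$, increase both $\phi(j,u)$ and $\phi(j,v)$ by $w'(j,e)$, push $e$ onto $S(j)$, and stop; if no such $j$ exists, $e$ is discarded. Output: $\mathcal{M}=\{M_1,\dots,M_k\}$.
   Formalization: The edge weights and the constant ε are taken to be rational. -}

module Defs where

open import Data.Nat using (ℕ; suc)
open import Data.Fin using (Fin; _<?_)
open import Data.Fin.Properties using () renaming (_≟_ to _≟ᶠ_)
open import Data.Rational using (ℚ; 0ℚ; 1ℚ; _+_; _-_; _*_; _≤_; _<_)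
open import Data.Rational.Properties using (_≤?_)
open import Data.List using (List; []; _∷_; foldr; map; allFin; filter)
open import Data.Bool.ListAction using (any)
open import Data.List.Membership.Propositional using (_∈_; _∉_)
open import Data.List.Relation.Unary.Unique.Propositional using (Unique)
open import Data.Bool using (Bool; true; false; _∨_; if_then_else_)
open import Data.Product using (_×_; _,_)
open import Data.Sum using (_⊎_)
open import Relation.Nullary using (¬_; does)
open import Relation.Binary.PropositionalEquality using (_≡_; _≢_)

record Graph (n m : ℕ) : Set where
  field
    end₁ end₂ : Fin m → Fin n
    w         : Fin m → ℚ
    noLoop    : ∀ e → end₁ e ≢ end₂ e
    simple    : ∀ e f → e ≢ f →
                ¬ ((end₁ e ≡ end₁ f × end₂ e ≡ end₂ f) ⊎ (end₁ e ≡ end₂ f × end₂ e ≡ end₁ f))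
    positive  : ∀ e → 0ℚ < w e

module _ {n m : ℕ} (G : Graph n m) where
  open Graph G

  shareEnd : Fin m → Fin m → Set
  shareEnd e f = end₁ e ≡ end₁ f ⊎ end₁ e ≡ end₂ f ⊎ end₂ e ≡ end₁ f ⊎ end₂ e ≡ end₂ f

  IsMatching : List (Fin m) → Set
  IsMatching M = Unique M × (∀ {e f} → e ∈ M → f ∈ M → e ≢ f → ¬ shareEnd e f)

  IsKDisjointMatching : (k : ℕ) → (Fin k → List (Fin m)) → Set
  IsKDisjointMatching k M =
    (∀ c → IsMatching (M c)) × (∀ c c' → c ≢ c' → ∀ {e} → e ∈ M c → e ∉ M c')

  sumℚ : List ℚ → ℚ
  sumℚ = foldr _+_ 0ℚ

  weight : ∀ {k} → (Fin k → List (Fin m)) → ℚ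
  weight {k} M = sumℚ (map (λ c → sumℚ (map w (M c))) (allFin k))

  module STK (k : ℕ) (ε : ℚ) where

    Potentials : Set
    Potentials = Fin k → Fin n → ℚ

    Stacks : Set
    Stacks = Fin k → List (Fin m)        -- head of the list = top of stack

    φsum : Potentials → Fin k → Fin m → ℚ
    φsum φ c e = φ c (end₁ e) + φ c (end₂ e)

    raise : Potentials → Fin k → Fin m → ℚ → Potentials
    raise φ c e δ c' x =
      if does (c' ≟ᶠ c) ∧' (does (x ≟ᶠ end₁ e) ∨ does (x ≟ᶠ end₂ e))
      then φ c' x + δ else φ c' x
      where
        _∧'_ : Bool → Bool → Bool
        true ∧' b = b
        false ∧' _ = false

    push : Stacks → Fin k → Fin m → Stacks
    push S c e c' = if does (c' ≟ᶠ c) then e ∷ S c' else S c'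

    tryColours : List (Fin k) → Fin m → Potentials × Stacks → Potentials × Stacks
    tryColours [] e st = st
    tryColours (c ∷ cs) e (φ , S) =
      if does (((1ℚ + ε) * φsum φ c e) ≤? w e)
      then (raise φ c e (w e - φsum φ c e) , push S c e)
      else tryColours cs e (φ , S)

    initial : Potentials × Stacks
    initial = ((λ _ _ → 0ℚ) , (λ _ → []))

    streaming : List (Fin m) → Potentials × Stacks → Potentials × Stacks
    streaming [] st = st
    streaming (e ∷ es) st = streaming es (tryColours (allFin k) e st)

    Matchings : Set
    Matchings = Fin k → List (Fin m)

    addTo : Matchings → Fin k → Fin m → Matchings
    addTo M c e c' = if does (c' ≟ᶠ c) then e ∷ M c' else M c'

    touched : List (Fin m) → Fin m → Bool
    touched L e = any (λ f → does (end₁ e ≟ᶠ end₁ f) ∨ does (end₁ e ≟ᶠ end₂ f)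
                           ∨ does (end₂ e ≟ᶠ end₁ f) ∨ does (end₂ e ≟ᶠ end₂ f)) L

    laterColours : Fin k → List (Fin k)
    laterColours c = filter (c <?_) (allFin k)

    -- During the
    -- processing of colour c only stacks S(j) with j > c are pushed to,
    -- so the contents of S(c) at the start of its phase are exactly the
    -- edges popped in that phase.
    popAll : Fin k → List (Fin m) → Potentials × Stacks × Matchings
           → Potentials × Stacks × Matchings
    popAll c [] st = st
    popAll c (e ∷ es) (φ , S , M) =
      if touched (M c) e
      then popAll c es (let (φ' , S') = tryColours (laterColours c) e (φ , S)
                        in (φ' , S' , M))
      else popAll c es (φ , S , addTo M c e)

    postProcess : List (Fin k) → Potentials × Stacks × Matchings
                → Potentials × Stacks × Matchings
    postProcess [] st = st
    postProcess (c ∷ cs) (φ , S , M) = postProcess cs (popAll c (S c) (φ , S , M))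

    run : List (Fin m) → Matchings
    run order with streaming order initial
    ... | (φ , S) with postProcess (allFin k) (φ , S , (λ _ → []))
    ...   | (_ , _ , M) = M

STK : ∀ {n m} → Graph n m → (k : ℕ) → ℚ → List (Fin m) → (Fin k → List (Fin m))
STK G k ε order = Graph-STK.run order
  where module Graph-STK = STK G k ε

-- For a colour c write w′(c,e) for the reduced weight w(e) − φ(c,u) − φ(c,v) of an edge e = (u,v)
-- when it is pushed on S(c), and W(c) for the sum of the w′(c,·) over the final S(c).
-- (1) Every edge ends up in the output or is covered by every colour c, i.e.
--     w(e) ≤ (1+ε)(φ(c,u)+φ(c,v)): a colour that did not take e found it covered, a colour
--     that took and later skipped e covers it from then on, and potentials never decrease.
-- (2) A push raises φ(c,u) and φ(c,v) by w′(c,e), so over any matching N the potential sums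
--     φ(c,u)+φ(c,v) add up to at most 2 W(c).
-- (3) While S(c) is popped, a kept edge pays its w′ with its own weight, and a skipped edge
--     with the potential it added to the edge of M_c it touches; hence W(c) ≤ w(M_c).
-- Applying (1) to the edges of M*_c, output edges contribute at most w(M) in total, and the
-- others at most (1+ε)·2W(c) ≤ 2(1+ε) w(M_c) by (2) and (3); so w(M*) ≤ (3+2ε) w(M).

module Submission where

open import Defs
open import Algebra.Bundles using (CommutativeMonoid)
open import Data.Bool using (Bool; true; false; T; if_then_else_; _∨_)
open import Data.Empty using (⊥-elim)
open import Data.Fin using (Fin; zero; suc; _<?_) renaming (_<_ to _<ᶠ_)
open import Data.Fin.Properties using ()
  renaming ( _≟_ to _≟ᶠ_; <⇒≢ to <ᶠ⇒≢; <-asym to <ᶠ-asym; <-irrefl to <ᶠ-irrefl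
           ; <-trans to <ᶠ-trans; <-cmp to <ᶠ-cmp)
open import Data.List using (List; []; _∷_; _++_; map; foldr; concatMap; allFin)
open import Data.List.Membership.Propositional using (_∈_; _∉_; find; lose)
open import Data.List.Membership.Propositional.Properties
  using (∈-++⁺ʳ; ∈-++⁻; ∈-allFin; ∈-tabulate⁺; ∈-concatMap⁺; ∈-concatMap⁻; ∈-filter⁺; ∈-filter⁻)
open import Data.List.Relation.Binary.Permutation.Propositional using (_↭_; ↭-sym; ↭⇒↭ₛ)
open import Data.List.Relation.Binary.Permutation.Propositional.Properties using (∈-resp-↭)
open import Data.List.Relation.Binary.Permutation.Setoid.Properties using (Unique-resp-↭)
open import Data.List.Relation.Unary.All as All using (All; []; _∷_)
open import Data.List.Relation.Unary.All.Properties using (¬Any⇒All¬; All¬⇒¬Any)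
open import Data.List.Relation.Unary.AllPairs as AllPairs using (AllPairs; []; _∷_)
import Data.List.Relation.Unary.AllPairs.Properties as AllPairsₚ
open import Data.List.Relation.Unary.Any as Any using (Any; here; there)
open import Data.List.Relation.Unary.Any.Properties using (any⁺; any⁻)
open import Data.List.Relation.Unary.Unique.Propositional using (Unique)
open import Data.List.Relation.Unary.Unique.Propositional.Properties using (++⁺; allFin⁺)
open import Data.Nat using (ℕ; suc; _≥_; z<s)
open import Data.Product using (_×_; _,_; ∃-syntax; proj₁; proj₂)
open import Data.Rational using (ℚ; 0ℚ; 1ℚ; _+_; _-_; _*_; _≤_; _<_; -_; nonNegative)
open import Data.Rational.Properties hiding (_<?_)
open import Data.Sum using (_⊎_; inj₁; inj₂; [_,_])
import Data.Sum as Sum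
open import Data.Unit using (⊤)
open import Function using (_∘_; id; case_of_)
open import Relation.Binary.Definitions using (tri<; tri≈; tri>)
open import Relation.Binary.PropositionalEquality hiding ([_])
open import Relation.Nullary using (¬_; does; Dec; yes; no)
open import Relation.Nullary.Decidable using (dec-true; dec-false; _⊎-dec_; dec⇒maybe)
open import Tactic.RingSolver using (solve-∀)
open import Tactic.RingSolver.Core.AlmostCommutativeRing using (AlmostCommutativeRing; fromCommutativeRing)

open import Algebra.Properties.CommutativeSemigroup
  (CommutativeMonoid.commutativeSemigroup +-0-commutativeMonoid) using (interchange; xy∙z≈xz∙y; x∙yz≈xz∙y)

ringℚ : AlmostCommutativeRing _ _
ringℚ = fromCommutativeRing +-*-commutativeRing (λ x → dec⇒maybe (0ℚ ≟ x))

p≤p+q : ∀ {p q} → 0ℚ ≤ q → p ≤ p + q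
p≤p+q {p} {q} 0≤q = subst (_≤ p + q) (+-identityʳ p) (+-monoʳ-≤ p 0≤q)

0≤p+q : ∀ {p q} → 0ℚ ≤ p → 0ℚ ≤ q → 0ℚ ≤ p + q
0≤p+q 0≤p 0≤q = ≤-trans 0≤p (p≤p+q 0≤q)

0≤q-p : ∀ {p q} → p ≤ q → 0ℚ ≤ q - p
0≤q-p {p} {q} p≤q = subst (_≤ q - p) (+-inverseʳ p) (+-monoˡ-≤ (- p) p≤q)

*-monoʳ-≤-0≤ : ∀ {r p q} → 0ℚ ≤ r → p ≤ q → r * p ≤ r * q
*-monoʳ-≤-0≤ {r} 0≤r = *-monoˡ-≤-nonNeg r {{nonNegative 0≤r}}

0≤p*q : ∀ {p q} → 0ℚ ≤ p → 0ℚ ≤ q → 0ℚ ≤ p * q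
0≤p*q {p} 0≤p 0≤q = subst (_≤ p * _) (*-zeroʳ p) (*-monoʳ-≤-0≤ 0≤p 0≤q)

+-cancelʳ-≤ : ∀ {p q} r → p + r ≤ q + r → p ≤ q
+-cancelʳ-≤ {p} {q} r p+r≤q+r =
  subst₂ _≤_ (cancel p r) (cancel q r) (+-monoˡ-≤ (- r) p+r≤q+r)
  where
  cancel : ∀ a d → (a + d) - d ≡ a
  cancel = solve-∀ ringℚ

∑ : {A : Set} → (A → ℚ) → List A → ℚ
∑ f xs = foldr _+_ 0ℚ (map f xs)

module _ {A : Set} where

  ∑-cong : ∀ {f g : A → ℚ} xs → (∀ {x} → x ∈ xs → f x ≡ g x) → ∑ f xs ≡ ∑ g xs
  ∑-cong []       f≡g = refl
  ∑-cong (x ∷ xs) f≡g = cong₂ _+_ (f≡g (here refl)) (∑-cong xs (f≡g ∘ there))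

  ∑-mono : ∀ {f g : A → ℚ} xs → (∀ {x} → x ∈ xs → f x ≤ g x) → ∑ f xs ≤ ∑ g xs
  ∑-mono []       f≤g = ≤-refl
  ∑-mono (x ∷ xs) f≤g = +-mono-≤ (f≤g (here refl)) (∑-mono xs (f≤g ∘ there))

  ∑-zero : ∀ (xs : List A) → ∑ (λ _ → 0ℚ) xs ≡ 0ℚ
  ∑-zero []       = refl
  ∑-zero (x ∷ xs) = trans (+-identityˡ _) (∑-zero xs)

  ∑-+ : ∀ (f g : A → ℚ) xs → ∑ (λ x → f x + g x) xs ≡ ∑ f xs + ∑ g xs
  ∑-+ f g []       = refl
  ∑-+ f g (x ∷ xs) = trans (cong (f x + g x +_) (∑-+ f g xs)) (interchange (f x) (g x) _ _)

  ∑-* : ∀ a (f : A → ℚ) xs → ∑ (λ x → a * f x) xs ≡ a * ∑ f xs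
  ∑-* a f []       = sym (*-zeroʳ a)
  ∑-* a f (x ∷ xs) = trans (cong (a * f x +_) (∑-* a f xs)) (sym (*-distribˡ-+ a (f x) _))

  ∑-++ : ∀ (f : A → ℚ) xs ys → ∑ f (xs ++ ys) ≡ ∑ f xs + ∑ f ys
  ∑-++ f []       ys = sym (+-identityˡ _)
  ∑-++ f (x ∷ xs) ys = trans (cong (f x +_) (∑-++ f xs ys)) (sym (+-assoc (f x) _ _))

  ∑-concatMap : ∀ {B : Set} (f : A → ℚ) (X : B → List A) bs →
                ∑ f (concatMap X bs) ≡ ∑ (λ b → ∑ f (X b)) bs
  ∑-concatMap f X []       = refl
  ∑-concatMap f X (b ∷ bs) = trans (∑-++ f (X b) _) (cong (∑ f (X b) +_) (∑-concatMap f X bs))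

  ∑-mono-+ : ∀ {f g : A → ℚ} {x} xs d → x ∈ xs → (∀ {y} → y ∈ xs → f y ≤ g y) →
             f x + d ≤ g x → ∑ f xs + d ≤ ∑ g xs
  ∑-mono-+ {f} {g} (x ∷ xs) d (here refl) f≤g fx+d≤gx =
    subst (_≤ ∑ g (x ∷ xs)) (xy∙z≈xz∙y (f x) d (∑ f xs)) (+-mono-≤ fx+d≤gx (∑-mono xs (f≤g ∘ there)))
  ∑-mono-+ {f} {g} (y ∷ xs) d (there x∈) f≤g fx+d≤gx =
    subst (_≤ ∑ g (y ∷ xs)) (sym (+-assoc (f y) (∑ f xs) d))
      (+-mono-≤ (f≤g (here refl)) (∑-mono-+ xs d x∈ (f≤g ∘ there) fx+d≤gx))

if-∨≤ : ∀ a b {W} → 0ℚ ≤ W → (if a ∨ b then W else 0ℚ) ≤ (if a then W else 0ℚ) + (if b then W else 0ℚ)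
if-∨≤ true  true  0≤W = p≤p+q 0≤W
if-∨≤ true  false _   = ≤-reflexive (sym (+-identityʳ _))
if-∨≤ false true  _   = ≤-reflexive (sym (+-identityˡ _))
if-∨≤ false false _   = ≤-refl

Unique-concatMap : ∀ {A B : Set} (X : B → List A) {bs} → Unique bs → (∀ b → Unique (X b)) →
                   (∀ b b′ → b ≢ b′ → ∀ {x} → x ∈ X b → x ∉ X b′) → Unique (concatMap X bs)
Unique-concatMap X {[]}     _             _        _        = []
Unique-concatMap X {b ∷ bs} (b∉bs ∷ uniq) X-unique disjoint =
  ++⁺ (X-unique b) (Unique-concatMap X uniq X-unique disjoint) λ (x∈Xb , x∈rest) →
    let (b′ , b′∈bs , x∈Xb′) = find (∈-concatMap⁻ X x∈rest) in
    disjoint b b′ (All.lookup b∉bs b′∈bs) x∈Xb x∈Xb′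

All-after : ∀ {A : Set} {R : A → A → Set} pre {j} post → AllPairs R (pre ++ j ∷ post) → All (R j) post
All-after []        post (Rj ∷ _) = Rj
All-after (_ ∷ pre) post (_ ∷ R*) = All-after pre post R*

if-true : ∀ {A : Set} {b} {x y : A} → b ≡ true → (if b then x else y) ≡ x
if-true refl = refl

if-false : ∀ {A : Set} {b} {x y : A} → b ≡ false → (if b then x else y) ≡ y
if-false refl = refl

T-does⇒ : ∀ {A : Set} (a? : Dec A) → T (does a?) → A
T-does⇒ (yes a) _ = a

⇒T-does : ∀ {A : Set} (a? : Dec A) → A → T (does a?)
⇒T-does a? a = subst T (sym (dec-true a? a)) _

module GraphPotentials {n m : ℕ} (G : Graph n m) where
  open Graph G

  _∈ᵉ_ : Fin n → Fin m → Set
  x ∈ᵉ e = x ≡ end₁ e ⊎ x ≡ end₂ e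

  _∈ᵉ?_ : ∀ x e → Dec (x ∈ᵉ e)
  x ∈ᵉ? e = x ≟ᶠ end₁ e ⊎-dec x ≟ᶠ end₂ e

  shareEnd-sym : ∀ {e f} → shareEnd G e f → shareEnd G f e
  shareEnd-sym (inj₁ p)                 = inj₁ (sym p)
  shareEnd-sym (inj₂ (inj₁ p))          = inj₂ (inj₂ (inj₁ (sym p)))
  shareEnd-sym (inj₂ (inj₂ (inj₁ p)))   = inj₂ (inj₁ (sym p))
  shareEnd-sym (inj₂ (inj₂ (inj₂ p)))   = inj₂ (inj₂ (inj₂ (sym p)))

  common-end⇒shareEnd : ∀ {x e f} → x ∈ᵉ e → x ∈ᵉ f → shareEnd G e f
  common-end⇒shareEnd (inj₁ refl) (inj₁ q) = inj₁ q
  common-end⇒shareEnd (inj₁ refl) (inj₂ q) = inj₂ (inj₁ q)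
  common-end⇒shareEnd (inj₂ refl) (inj₁ q) = inj₂ (inj₂ (inj₁ q))
  common-end⇒shareEnd (inj₂ refl) (inj₂ q) = inj₂ (inj₂ (inj₂ q))

  shareEnd⇒end-∈ᵉ : ∀ {e f} → shareEnd G e f → end₁ f ∈ᵉ e ⊎ end₂ f ∈ᵉ e
  shareEnd⇒end-∈ᵉ (inj₁ p)               = inj₁ (inj₁ (sym p))
  shareEnd⇒end-∈ᵉ (inj₂ (inj₁ p))        = inj₂ (inj₁ (sym p))
  shareEnd⇒end-∈ᵉ (inj₂ (inj₂ (inj₁ p))) = inj₁ (inj₂ (sym p))
  shareEnd⇒end-∈ᵉ (inj₂ (inj₂ (inj₂ p))) = inj₂ (inj₂ (sym p))

  -- does (shareEnd? e f) is, definitionally, the test that touched applies to e and f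
  shareEnd? : ∀ e f → Dec (shareEnd G e f)
  shareEnd? e f =
    end₁ e ≟ᶠ end₁ f ⊎-dec end₁ e ≟ᶠ end₂ f ⊎-dec end₂ e ≟ᶠ end₁ f ⊎-dec end₂ e ≟ᶠ end₂ f

  IsMatching-∷ : ∀ {e L} → IsMatching G L → (∀ {f} → f ∈ L → ¬ shareEnd G e f) → IsMatching G (e ∷ L)
  IsMatching-∷ {e} {L} (uniq , disj) e#L =
    (¬Any⇒All¬ L (λ e∈L → e#L e∈L (inj₁ refl)) ∷ uniq) , pairwise
    where
    pairwise : ∀ {a b} → a ∈ e ∷ L → b ∈ e ∷ L → a ≢ b → ¬ shareEnd G a b
    pairwise (here refl) (here refl) a≢b _  = a≢b refl
    pairwise (here refl) (there b∈)  _      = e#L b∈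
    pairwise (there a∈)  (here refl) _ sh   = e#L a∈ (shareEnd-sym sh)
    pairwise (there a∈)  (there b∈)  a≢b    = disj a∈ b∈ a≢b

  IsMatching-tail : ∀ {e L} → IsMatching G (e ∷ L) → IsMatching G L
  IsMatching-tail ((_ ∷ uniq) , disj) = uniq , λ a∈ b∈ → disj (there a∈) (there b∈)

  endSum : (Fin n → ℚ) → Fin m → ℚ
  endSum p e = p (end₁ e) + p (end₂ e)

  raiseAt : (Fin n → ℚ) → Fin n → ℚ → Fin n → ℚ
  raiseAt p a δ x = if does (x ≟ᶠ a) then p x + δ else p x

  raiseEnds : (Fin n → ℚ) → Fin m → ℚ → Fin n → ℚ
  raiseEnds p e δ x = if does (x ∈ᵉ? e) then p x + δ else p x

  reduced : (Fin n → ℚ) → Fin m → ℚ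
  reduced p e = w e - endSum p e

  NonNeg : (Fin n → ℚ) → Set
  NonNeg p = ∀ x → 0ℚ ≤ p x

  0≤endSum : ∀ {p} → NonNeg p → ∀ e → 0ℚ ≤ endSum p e
  0≤endSum 0≤p e = 0≤p+q (0≤p _) (0≤p _)

  endSum-cong : ∀ {p q} → p ≗ q → ∀ e → endSum p e ≡ endSum q e
  endSum-cong p≗q e = cong₂ _+_ (p≗q (end₁ e)) (p≗q (end₂ e))

  raiseEnds-reduced-cong : ∀ {p q} → p ≗ q → ∀ e → raiseEnds p e (reduced p e) ≗ raiseEnds q e (reduced q e)
  raiseEnds-reduced-cong p≗q e x =
    cong₂ (λ a d → if does (x ∈ᵉ? e) then a + d else a) (p≗q x) (cong (_-_ (w e)) (cong₂ _+_ (p≗q _) (p≗q _)))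

  module _ (p : Fin n → ℚ) {δ : ℚ} where

    raiseAt-hit : ∀ {a x} → x ≡ a → raiseAt p a δ x ≡ p x + δ
    raiseAt-hit {a} {x} x≡a = if-true (dec-true (x ≟ᶠ a) x≡a)

    raiseAt-miss : ∀ {a x} → x ≢ a → raiseAt p a δ x ≡ p x
    raiseAt-miss {a} {x} x≢a = if-false (dec-false (x ≟ᶠ a) x≢a)

    raiseEnds-hit : ∀ {e x} → x ∈ᵉ e → raiseEnds p e δ x ≡ p x + δ
    raiseEnds-hit {e} {x} x∈e = if-true (dec-true (x ∈ᵉ? e) x∈e)

    raiseEnds-miss : ∀ {e x} → ¬ x ∈ᵉ e → raiseEnds p e δ x ≡ p x
    raiseEnds-miss {e} {x} x∉e = if-false (dec-false (x ∈ᵉ? e) x∉e)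

    endSum-raiseAt-∈ᵉ : ∀ {a e} → a ∈ᵉ e → endSum (raiseAt p a δ) e ≡ endSum p e + δ
    endSum-raiseAt-∈ᵉ {e = e} (inj₁ refl) =
      trans (cong₂ _+_ (raiseAt-hit refl) (raiseAt-miss (noLoop e ∘ sym)))
            (xy∙z≈xz∙y (p (end₁ e)) δ (p (end₂ e)))
    endSum-raiseAt-∈ᵉ {e = e} (inj₂ refl) =
      trans (cong₂ _+_ (raiseAt-miss (noLoop e)) (raiseAt-hit refl))
            (sym (+-assoc (p (end₁ e)) (p (end₂ e)) δ))

    endSum-raiseAt-∉ᵉ : ∀ {a e} → ¬ a ∈ᵉ e → endSum (raiseAt p a δ) e ≡ endSum p e
    endSum-raiseAt-∉ᵉ a∉e =
      cong₂ _+_ (raiseAt-miss (a∉e ∘ inj₁ ∘ sym)) (raiseAt-miss (a∉e ∘ inj₂ ∘ sym))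

  module _ {δ : ℚ} (0≤δ : 0ℚ ≤ δ) where

    raiseAt-≥ : ∀ p a x → p x ≤ raiseAt p a δ x
    raiseAt-≥ p a x with x ≟ᶠ a
    ... | yes _ = p≤p+q 0≤δ
    ... | no  _ = ≤-refl

    raiseEnds-≥ : ∀ p e x → p x ≤ raiseEnds p e δ x
    raiseEnds-≥ p e x with x ∈ᵉ? e
    ... | yes x∈e = subst (p x ≤_) (sym (raiseEnds-hit p x∈e)) (p≤p+q 0≤δ)
    ... | no  x∉e = ≤-reflexive (sym (raiseEnds-miss p x∉e))

    raiseEnds≤raiseAt² : ∀ p e x → raiseEnds p e δ x ≤ raiseAt (raiseAt p (end₁ e) δ) (end₂ e) δ x
    raiseEnds≤raiseAt² p e x = by-cases (x ≟ᶠ end₁ e) (x ≟ᶠ end₂ e)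
      where
      rhs = raiseAt (raiseAt p (end₁ e) δ) (end₂ e) δ x
      by-cases : Dec (x ≡ end₁ e) → Dec (x ≡ end₂ e) → raiseEnds p e δ x ≤ rhs
      by-cases (yes x≡e₁) _ = begin
        raiseEnds p e δ x       ≡⟨ raiseEnds-hit p (inj₁ x≡e₁) ⟩
        p x + δ                 ≡⟨ raiseAt-hit p x≡e₁ ⟨
        raiseAt p (end₁ e) δ x  ≤⟨ raiseAt-≥ (raiseAt p (end₁ e) δ) (end₂ e) x ⟩
        rhs                     ∎
        where open ≤-Reasoning
      by-cases (no x≢e₁) (yes x≡e₂) = ≤-reflexive (begin
        raiseEnds p e δ x           ≡⟨ raiseEnds-hit p (inj₂ x≡e₂) ⟩
        p x + δ                     ≡⟨ cong (_+ δ) (raiseAt-miss p x≢e₁) ⟨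
        raiseAt p (end₁ e) δ x + δ  ≡⟨ raiseAt-hit (raiseAt p (end₁ e) δ) x≡e₂ ⟨
        rhs                         ∎)
        where open ≡-Reasoning
      by-cases (no x≢e₁) (no x≢e₂) = ≤-reflexive (begin
        raiseEnds p e δ x       ≡⟨ raiseEnds-miss p [ x≢e₁ , x≢e₂ ] ⟩
        p x                     ≡⟨ raiseAt-miss p x≢e₁ ⟨
        raiseAt p (end₁ e) δ x  ≡⟨ raiseAt-miss (raiseAt p (end₁ e) δ) x≢e₂ ⟨
        rhs                     ∎)
        where open ≡-Reasoning

    -- δ is counted at most once: a is an end of at most one edge of the matching N
    ∑-endSum-raiseAt : ∀ {N} → IsMatching G N → ∀ p a →
                       ∑ (endSum (raiseAt p a δ)) N ≤ ∑ (endSum p) N + δ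
    ∑-endSum-raiseAt {[]}    _ p a = p≤p+q 0≤δ
    ∑-endSum-raiseAt {e ∷ N} N-matching@((e∉N ∷ _) , disjoint) p a with a ∈ᵉ? e
    ... | yes a∈e = ≤-reflexive (begin
      endSum (raiseAt p a δ) e + ∑ (endSum (raiseAt p a δ)) N
        ≡⟨ cong₂ _+_ (endSum-raiseAt-∈ᵉ p a∈e) (∑-cong N (endSum-raiseAt-∉ᵉ p ∘ a∉ᵉ)) ⟩
      (endSum p e + δ) + ∑ (endSum p) N
        ≡⟨ xy∙z≈xz∙y (endSum p e) δ (∑ (endSum p) N) ⟩
      (endSum p e + ∑ (endSum p) N) + δ ∎)
      where
      open ≡-Reasoning
      a∉ᵉ : ∀ {f} → f ∈ N → ¬ a ∈ᵉ f
      a∉ᵉ f∈N a∈f = disjoint (here refl) (there f∈N) (All.lookup e∉N f∈N) (common-end⇒shareEnd a∈e a∈f)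
    ... | no a∉e = begin
      endSum (raiseAt p a δ) e + ∑ (endSum (raiseAt p a δ)) N
        ≤⟨ +-mono-≤ (≤-reflexive (endSum-raiseAt-∉ᵉ p a∉e)) (∑-endSum-raiseAt (IsMatching-tail N-matching) p a) ⟩
      endSum p e + (∑ (endSum p) N + δ)
        ≡⟨ +-assoc (endSum p e) (∑ (endSum p) N) δ ⟨
      (endSum p e + ∑ (endSum p) N) + δ ∎
      where open ≤-Reasoning

    ∑-endSum-raiseEnds : ∀ {N} → IsMatching G N → ∀ p e →
                         ∑ (endSum (raiseEnds p e δ)) N ≤ ∑ (endSum p) N + (δ + δ)
    ∑-endSum-raiseEnds {N} N-matching p e = begin
      ∑ (endSum (raiseEnds p e δ)) N
        ≤⟨ ∑-mono N (λ {f} _ → +-mono-≤ (raiseEnds≤raiseAt² p e (end₁ f)) (raiseEnds≤raiseAt² p e (end₂ f))) ⟩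
      ∑ (endSum (raiseAt (raiseAt p (end₁ e) δ) (end₂ e) δ)) N
        ≤⟨ ∑-endSum-raiseAt N-matching (raiseAt p (end₁ e) δ) (end₂ e) ⟩
      ∑ (endSum (raiseAt p (end₁ e) δ)) N + δ
        ≤⟨ +-monoˡ-≤ δ (∑-endSum-raiseAt N-matching p (end₁ e)) ⟩
      (∑ (endSum p) N + δ) + δ
        ≡⟨ +-assoc (∑ (endSum p) N) δ δ ⟩
      ∑ (endSum p) N + (δ + δ) ∎
      where open ≤-Reasoning

    endSum-raiseEnds-shareEnd : ∀ p {e f} → shareEnd G e f → endSum p f + δ ≤ endSum (raiseEnds p e δ) f
    endSum-raiseEnds-shareEnd p {e} {f} sh with shareEnd⇒end-∈ᵉ sh
    ... | inj₁ f₁∈e = begin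
      (p (end₁ f) + p (end₂ f)) + δ         ≡⟨ xy∙z≈xz∙y (p (end₁ f)) δ (p (end₂ f)) ⟨
      (p (end₁ f) + δ) + p (end₂ f)
        ≤⟨ +-mono-≤ (≤-reflexive (sym (raiseEnds-hit p f₁∈e))) (raiseEnds-≥ p e _) ⟩
      endSum (raiseEnds p e δ) f ∎
      where open ≤-Reasoning
    ... | inj₂ f₂∈e = begin
      (p (end₁ f) + p (end₂ f)) + δ         ≡⟨ +-assoc (p (end₁ f)) (p (end₂ f)) δ ⟩
      p (end₁ f) + (p (end₂ f) + δ)
        ≤⟨ +-mono-≤ (raiseEnds-≥ p e _) (≤-reflexive (sym (raiseEnds-hit p f₂∈e))) ⟩
      endSum (raiseEnds p e δ) f ∎
      where open ≤-Reasoning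

module Analysis {n m : ℕ} (G : Graph n m) (k′ : ℕ) (ε : ℚ) (0<ε : 0ℚ < ε) where
  open Graph G
  open GraphPotentials G

  k : ℕ
  k = suc k′

  open STK G k ε

  0≤1+ε : 0ℚ ≤ 1ℚ + ε
  0≤1+ε = 0≤p+q (nonNegative⁻¹ 1ℚ) (<⇒≤ 0<ε)

  p≤[1+ε]*p : ∀ {p} → 0ℚ ≤ p → p ≤ (1ℚ + ε) * p
  p≤[1+ε]*p {p} 0≤p = begin
    p                 ≤⟨ p≤p+q (0≤p*q (<⇒≤ 0<ε) 0≤p) ⟩
    p + ε * p         ≡⟨ cong (_+ ε * p) (*-identityˡ p) ⟨
    1ℚ * p + ε * p    ≡⟨ *-distribʳ-+ p 1ℚ ε ⟨
    (1ℚ + ε) * p      ∎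
    where open ≤-Reasoning

  Accepts : (Fin n → ℚ) → Fin m → Set
  Accepts p e = (1ℚ + ε) * endSum p e ≤ w e

  Covered : (Fin n → ℚ) → Fin m → Set
  Covered p e = w e ≤ (1ℚ + ε) * endSum p e

  ¬Accepts⇒Covered : ∀ {p e} → ¬ Accepts p e → Covered p e
  ¬Accepts⇒Covered = <⇒≤ ∘ ≰⇒>

  0≤reduced : ∀ {p e} → NonNeg p → Accepts p e → 0ℚ ≤ reduced p e
  0≤reduced {p} {e} 0≤p accepts = 0≤q-p (≤-trans (p≤[1+ε]*p (0≤endSum 0≤p e)) accepts)

  Covered-mono : ∀ {p q e} → (∀ x → p x ≤ q x) → Covered p e → Covered q e
  Covered-mono p≤q covered = ≤-trans covered (*-monoʳ-≤-0≤ 0≤1+ε (+-mono-≤ (p≤q _) (p≤q _)))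

  -- For the stack R of a colour c (top first), potentialOf R is φ(c,·) and reducedTotal R is W(c).
  potentialOf : List (Fin m) → Fin n → ℚ
  potentialOf []      = λ _ → 0ℚ
  potentialOf (e ∷ R) = raiseEnds (potentialOf R) e (reduced (potentialOf R) e)

  reducedTotal : List (Fin m) → ℚ
  reducedTotal []      = 0ℚ
  reducedTotal (e ∷ R) = reduced (potentialOf R) e + reducedTotal R

  Admissible : List (Fin m) → Set
  Admissible []      = ⊤
  Admissible (e ∷ R) = Accepts (potentialOf R) e × Admissible R

  potentialOf-nonNeg : ∀ R → Admissible R → NonNeg (potentialOf R)
  potentialOf-nonNeg []      _                  x = ≤-refl
  potentialOf-nonNeg (e ∷ R) (accepts , adm-R) x =
    ≤-trans (potentialOf-nonNeg R adm-R x)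
            (raiseEnds-≥ (0≤reduced (potentialOf-nonNeg R adm-R) accepts) (potentialOf R) e x)

  reduced-potentialOf-nonNeg : ∀ {e R} → Admissible (e ∷ R) → 0ℚ ≤ reduced (potentialOf R) e
  reduced-potentialOf-nonNeg {R = R} (accepts , adm-R) = 0≤reduced (potentialOf-nonNeg R adm-R) accepts

  ∑-endSum-potentialOf : ∀ R → Admissible R → ∀ {N} → IsMatching G N →
                         ∑ (endSum (potentialOf R)) N ≤ (1ℚ + 1ℚ) * reducedTotal R
  ∑-endSum-potentialOf []      _   {N} _ = ≤-reflexive (∑-zero N)
  ∑-endSum-potentialOf (e ∷ R) adm {N} N-matching = begin
    ∑ (endSum (raiseEnds (potentialOf R) e δ)) N
      ≤⟨ ∑-endSum-raiseEnds (reduced-potentialOf-nonNeg adm) N-matching (potentialOf R) e ⟩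
    ∑ (endSum (potentialOf R)) N + (δ + δ)
      ≤⟨ +-monoˡ-≤ (δ + δ) (∑-endSum-potentialOf R (proj₂ adm) N-matching) ⟩
    (1ℚ + 1ℚ) * reducedTotal R + (δ + δ)
      ≡⟨ regroup δ (reducedTotal R) ⟩
    (1ℚ + 1ℚ) * (δ + reducedTotal R) ∎
    where
    open ≤-Reasoning
    δ = reduced (potentialOf R) e
    regroup : ∀ d W → (1ℚ + 1ℚ) * W + (d + d) ≡ (1ℚ + 1ℚ) * (d + W)
    regroup = solve-∀ ringℚ

  endSum-potentialOf-∷ : ∀ {e R} → Admissible (e ∷ R) → ∀ f →
                         endSum (potentialOf R) f ≤ endSum (potentialOf (e ∷ R)) f
  endSum-potentialOf-∷ {e} {R} adm f =
    +-mono-≤ (raiseEnds-≥ 0≤δ (potentialOf R) e (end₁ f)) (raiseEnds-≥ 0≤δ (potentialOf R) e (end₂ f))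
    where 0≤δ = reduced-potentialOf-nonNeg adm

  -- Popping e in the phase of colour c₀, with W = W(c₀) and N = M c₀ (see PopInv.charge).
  module _ (W : ℚ) (N : List (Fin m)) {e R} (adm : Admissible (e ∷ R))
           (charge : W + ∑ (endSum (potentialOf (e ∷ R))) N ≤ ∑ w N + reducedTotal (e ∷ R)) where
    private
      pR = potentialOf R
      δ = reduced pR e
      A = ∑ (endSum pR) N
      A′ = ∑ (endSum (potentialOf (e ∷ R))) N

    charge-keep : W + ∑ (endSum pR) (e ∷ N) ≤ ∑ w (e ∷ N) + reducedTotal R
    charge-keep = begin
      W + (endSum pR e + A)                         ≡⟨ x∙yz≈xz∙y W (endSum pR e) A ⟩
      (W + A) + endSum pR e                         ≤⟨ +-monoˡ-≤ (endSum pR e) (+-monoʳ-≤ W A≤A′) ⟩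
      (W + A′) + endSum pR e                        ≤⟨ +-monoˡ-≤ (endSum pR e) charge ⟩
      (∑ w N + (δ + reducedTotal R)) + endSum pR e  ≡⟨ regroup (∑ w N) (reducedTotal R) (w e) (endSum pR e) ⟩
      (w e + ∑ w N) + reducedTotal R                ∎
      where
      open ≤-Reasoning
      A≤A′ : A ≤ A′
      A≤A′ = ∑-mono N (λ {f} _ → endSum-potentialOf-∷ adm f)
      regroup : ∀ X Y x s → (X + ((x - s) + Y)) + s ≡ (x + X) + Y
      regroup = solve-∀ ringℚ

    charge-skip : ∀ {f} → f ∈ N → shareEnd G e f → W + ∑ (endSum pR) N ≤ ∑ w N + reducedTotal R
    charge-skip f∈N shares = +-cancelʳ-≤ δ (begin
      (W + A) + δ                      ≡⟨ +-assoc W A δ ⟩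
      W + (A + δ)                      ≤⟨ +-monoʳ-≤ W A+δ≤A′ ⟩
      W + A′                           ≤⟨ charge ⟩
      ∑ w N + (δ + reducedTotal R)     ≡⟨ x∙yz≈xz∙y (∑ w N) δ (reducedTotal R) ⟩
      (∑ w N + reducedTotal R) + δ     ∎)
      where
      open ≤-Reasoning
      A+δ≤A′ : A + δ ≤ A′
      A+δ≤A′ = ∑-mono-+ N δ f∈N (λ {f} _ → endSum-potentialOf-∷ adm f)
                 (endSum-raiseEnds-shareEnd (reduced-potentialOf-nonNeg adm) pR shares)

  raise-here : ∀ φ c e δ x → raise φ c e δ c x ≡ raiseEnds (φ c) e δ x
  raise-here φ c e δ x rewrite dec-true (c ≟ᶠ c) refl = refl

  push-here : ∀ S c e → push S c e c ≡ e ∷ S c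
  push-here S c e rewrite dec-true (c ≟ᶠ c) refl = refl

  Consistent : Potentials → Stacks → Set
  Consistent φ S = ∀ c → φ c ≗ potentialOf (S c) × Admissible (S c)

  consistent-nonNeg : ∀ {φ S} → Consistent φ S → ∀ c → NonNeg (φ c)
  consistent-nonNeg {φ} {S} consistent c x =
    subst (0ℚ ≤_) (sym (proj₁ (consistent c) x)) (potentialOf-nonNeg (S c) (proj₂ (consistent c)) x)

  _≤ᵖ_ : Potentials → Potentials → Set
  φ ≤ᵖ φ′ = ∀ c x → φ c x ≤ φ′ c x

  data Grows (cs : List (Fin k)) (e : Fin m) (S : Stacks) : Stacks → Set where
    unchanged : Grows cs e S S
    pushedOn  : ∀ {j} → j ∈ cs → Grows cs e S (push S j e)

  Grows-shape : ∀ {cs e S S′} → Grows cs e S S′ → ∀ c → S′ c ≡ S c ⊎ (c ∈ cs × S′ c ≡ e ∷ S c)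
  Grows-shape unchanged c = inj₁ refl
  Grows-shape (pushedOn {j} j∈cs) c with c ≟ᶠ j
  ... | yes refl = inj₂ (j∈cs , refl)
  ... | no  _    = inj₁ refl

  Grows-once : ∀ {cs e S S′} → Grows cs e S S′ →
               ∀ {c c′} → e ∈ S′ c → e ∈ S′ c′ → e ∉ S c → e ∉ S c′ → c ≡ c′
  Grows-once unchanged e∈ _ e∉ _ = ⊥-elim (e∉ e∈)
  Grows-once {e = e} {S} (pushedOn {j} _) e∈ e∈′ e∉ e∉′ = trans (onto-j e∈ e∉) (sym (onto-j e∈′ e∉′))
    where
    onto-j : ∀ {c} → e ∈ push S j e c → e ∉ S c → c ≡ j
    onto-j {c} e∈ e∉ with c ≟ᶠ j
    ... | yes c≡j = c≡j
    ... | no  _   = ⊥-elim (e∉ e∈)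

  module _ {cs e S S′} (grows : Grows cs e S S′) where

    Grows-∈ : ∀ {x c} → x ∈ S c → x ∈ S′ c
    Grows-∈ {x} {c} x∈ with Grows-shape grows c
    ... | inj₁ S′c≡       = subst (x ∈_) (sym S′c≡) x∈
    ... | inj₂ (_ , S′c≡) = subst (x ∈_) (sym S′c≡) (there x∈)

    Grows-∈⁻ : ∀ {x c} → x ∈ S′ c → (x ≡ e × c ∈ cs) ⊎ x ∈ S c
    Grows-∈⁻ {x} {c} x∈ with Grows-shape grows c
    ... | inj₁ S′c≡ = inj₂ (subst (x ∈_) S′c≡ x∈)
    ... | inj₂ (c∈cs , S′c≡) with subst (x ∈_) S′c≡ x∈
    ...   | here x≡e   = inj₁ (x≡e , c∈cs)
    ...   | there x∈Sc = inj₂ x∈Sc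

    Grows-∉ : ∀ {c} → c ∉ cs → S′ c ≡ S c
    Grows-∉ {c} c∉cs with Grows-shape grows c
    ... | inj₁ S′c≡       = S′c≡
    ... | inj₂ (c∈cs , _) = ⊥-elim (c∉cs c∈cs)

    Grows-unique : ∀ {c} → Unique (S c) → e ∉ S c → Unique (S′ c)
    Grows-unique {c} unique e∉ with Grows-shape grows c
    ... | inj₁ S′c≡       = subst Unique (sym S′c≡) unique
    ... | inj₂ (_ , S′c≡) = subst Unique (sym S′c≡) (¬Any⇒All¬ (S c) e∉ ∷ unique)

  module Push {φ S} (consistent : Consistent φ S) {j e} (accepts : Accepts (φ j) e) where

    δ : ℚ
    δ = reduced (φ j) e

    φ′ : Potentials
    φ′ = raise φ j e δ

    S′ : Stacks
    S′ = push S j e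

    0≤δ : 0ℚ ≤ δ
    0≤δ = 0≤reduced (consistent-nonNeg consistent j) accepts

    φ≤φ′ : φ ≤ᵖ φ′
    φ≤φ′ c x with c ≟ᶠ j
    ... | yes refl = raiseEnds-≥ 0≤δ (φ c) e x
    ... | no  _    = ≤-refl

    covered : Covered (φ′ j) e
    covered = ≤-trans w≤endSum (p≤[1+ε]*p (0≤endSum φ′j-nonNeg e))
      where
      φ′j-nonNeg : NonNeg (φ′ j)
      φ′j-nonNeg x = ≤-trans (consistent-nonNeg consistent j x) (φ≤φ′ j x)
      w≤endSum : w e ≤ endSum (φ′ j) e
      w≤endSum = begin
        w e                               ≡⟨ cancel (w e) (endSum (φ j) e) ⟩
        endSum (φ j) e + δ                ≤⟨ endSum-raiseEnds-shareEnd 0≤δ (φ j) (inj₁ refl) ⟩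
        endSum (raiseEnds (φ j) e δ) e    ≡⟨ endSum-cong (raise-here φ j e δ) e ⟨
        endSum (φ′ j) e                   ∎
        where
        open ≤-Reasoning
        cancel : ∀ a b → a ≡ b + (a - b)
        cancel = solve-∀ ringℚ

    consistent′ : Consistent φ′ S′
    consistent′ c with c ≟ᶠ j
    ... | yes refl = raiseEnds-reduced-cong φc≗ e
                   , subst (λ s → (1ℚ + ε) * s ≤ w e) (endSum-cong φc≗ e) accepts , proj₂ (consistent c)
      where φc≗ = proj₁ (consistent c)
    ... | no  _    = consistent c

    e∈S′ : e ∈ S′ j
    e∈S′ = subst (e ∈_) (sym (push-here S j e)) (here refl)

  data TryView (e : Fin m) (φ : Potentials) (S : Stacks) : List (Fin k) → Potentials × Stacks → Set where
    rejected : ∀ {cs} → All (λ c → Covered (φ c) e) cs → TryView e φ S cs (φ , S)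
    accepted : ∀ pre j post → All (λ c → Covered (φ c) e) pre → Accepts (φ j) e →
               TryView e φ S (pre ++ j ∷ post) (raise φ j e (reduced (φ j) e) , push S j e)

  tryView-∷ : ∀ {e φ S c cs r} → ¬ Accepts (φ c) e → TryView e φ S cs r → TryView e φ S (c ∷ cs) r
  tryView-∷ {φ = φ} {c = c} ¬accepts (rejected covered) =
    rejected (¬Accepts⇒Covered {φ c} ¬accepts ∷ covered)
  tryView-∷ {φ = φ} {c = c} ¬accepts (accepted pre j post covered accepts) =
    accepted (c ∷ pre) j post (¬Accepts⇒Covered {φ c} ¬accepts ∷ covered) accepts

  tryView : ∀ cs e φ S → TryView e φ S cs (tryColours cs e (φ , S))
  tryView []       e φ S = rejected []
  tryView (c ∷ cs) e φ S = by-cases ((1ℚ + ε) * φsum φ c e ≤? w e)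
    where
    by-cases : (accepts? : Dec (Accepts (φ c) e)) →
               TryView e φ S (c ∷ cs) (if does accepts?
                                        then (raise φ c e (reduced (φ c) e) , push S c e)
                                        else tryColours cs e (φ , S))
    by-cases (yes accepts) = accepted [] c cs [] accepts
    by-cases (no ¬accepts) = tryView-∷ ¬accepts (tryView cs e φ S)

  record TrySpec (cs : List (Fin k)) (e : Fin m) (φ : Potentials) (S : Stacks) (result : Potentials × Stacks) : Set where
    φ′ = proj₁ result
    S′ = proj₂ result
    field
      consistent : Consistent φ′ S′
      monotone   : φ ≤ᵖ φ′
      grows      : Grows cs e S S′
      covered    : ∀ {c} → c ∈ cs → Covered (φ′ c) e ⊎ ∃[ j ] j <ᶠ c × j ∈ cs × e ∈ S′ j

  trySpec-view : ∀ {cs e φ S r} → AllPairs _<ᶠ_ cs → Consistent φ S → TryView e φ S cs r → TrySpec cs e φ S r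
  trySpec-view _ consistent (rejected covered) = record
    { consistent = consistent ; monotone = λ _ _ → ≤-refl ; grows = unchanged ; covered = inj₁ ∘ All.lookup covered }
  trySpec-view sorted consistent (accepted pre j post covered accepts) = record
    { consistent = P.consistent′ ; monotone = P.φ≤φ′ ; grows = pushedOn j∈cs ; covered = covered′ }
    where
    module P = Push consistent accepts
    j∈cs = ∈-++⁺ʳ pre (here refl)
    covered′ : ∀ {c} → c ∈ pre ++ j ∷ post →
               Covered (P.φ′ c) _ ⊎ ∃[ j′ ] j′ <ᶠ c × j′ ∈ pre ++ j ∷ post × _ ∈ P.S′ j′
    covered′ c∈ with ∈-++⁻ pre c∈
    ... | inj₁ c∈pre          = inj₁ (Covered-mono (P.φ≤φ′ _) (All.lookup covered c∈pre))
    ... | inj₂ (here refl)    = inj₁ P.covered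
    ... | inj₂ (there c∈post) = inj₂ (j , All.lookup (All-after pre post sorted) c∈post , j∈cs , P.e∈S′)

  trySpec : ∀ cs → AllPairs _<ᶠ_ cs → ∀ e {φ S} → Consistent φ S → TrySpec cs e φ S (tryColours cs e (φ , S))
  trySpec cs sorted e {φ} {S} consistent = trySpec-view sorted consistent (tryView cs e φ S)

  allFin-sorted : AllPairs _<ᶠ_ (allFin k)
  allFin-sorted = AllPairsₚ.tabulate⁺-< id

  record StreamInv (rs : List (Fin m)) (state : Potentials × Stacks) : Set where
    φ = proj₁ state
    S = proj₂ state
    field
      consistent    : Consistent φ S
      covered       : ∀ e → e ∈ rs ⊎ (∀ c → Covered (φ c) e ⊎ ∃[ c′ ] c′ <ᶠ c × e ∈ S c′)
      rs-unique     : Unique rs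
      stacks-unique : ∀ c → Unique (S c)
      rs#stacks     : ∀ {e} c → e ∈ rs → e ∉ S c
      stacks#stacks : ∀ {e} c c′ → c ≢ c′ → e ∈ S c → e ∉ S c′

  streamInv-step : ∀ {e rs state} → StreamInv (e ∷ rs) state → StreamInv rs (tryColours (allFin k) e state)
  streamInv-step {e} {rs} I = record
    { consistent    = T.consistent
    ; covered       = covered
    ; rs-unique     = AllPairs.tail I.rs-unique
    ; stacks-unique = λ c → Grows-unique T.grows (I.stacks-unique c) (I.rs#stacks c (here refl))
    ; rs#stacks     = rs#stacks
    ; stacks#stacks = stacks#stacks
    }
    where
    module I = StreamInv I
    module T = TrySpec (trySpec (allFin k) allFin-sorted e I.consistent)
    covered : ∀ e′ → e′ ∈ rs ⊎ (∀ c → Covered (T.φ′ c) e′ ⊎ ∃[ c′ ] c′ <ᶠ c × e′ ∈ T.S′ c′)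
    covered e′ with I.covered e′
    ... | inj₁ (here refl)   = inj₂ λ c → Sum.map₂ (λ (j , j<c , _ , e∈) → j , j<c , e∈) (T.covered (∈-allFin c))
    ... | inj₁ (there e′∈rs) = inj₁ e′∈rs
    ... | inj₂ done          =
      inj₂ λ c → Sum.map (Covered-mono (T.monotone c))
                         (λ (c′ , c′<c , e′∈) → c′ , c′<c , Grows-∈ T.grows e′∈) (done c)
    rs#stacks : ∀ {x} c → x ∈ rs → x ∉ T.S′ c
    rs#stacks c x∈rs x∈S′ with Grows-∈⁻ T.grows x∈S′
    ... | inj₁ (refl , _) = All¬⇒¬Any (AllPairs.head I.rs-unique) x∈rs
    ... | inj₂ x∈S        = I.rs#stacks c (there x∈rs) x∈S
    stacks#stacks : ∀ {x} c c′ → c ≢ c′ → x ∈ T.S′ c → x ∉ T.S′ c′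
    stacks#stacks c c′ c≢c′ x∈ x∈′ with Grows-∈⁻ T.grows x∈ | Grows-∈⁻ T.grows x∈′
    ... | inj₁ (refl , _) | inj₁ _          =
      c≢c′ (Grows-once T.grows x∈ x∈′ (I.rs#stacks c (here refl)) (I.rs#stacks c′ (here refl)))
    ... | inj₁ (refl , _) | inj₂ x∈′S       = I.rs#stacks c′ (here refl) x∈′S
    ... | inj₂ x∈S        | inj₁ (refl , _) = I.rs#stacks c (here refl) x∈S
    ... | inj₂ x∈S        | inj₂ x∈′S       = I.stacks#stacks c c′ c≢c′ x∈S x∈′S

  streamInv : ∀ rs state → StreamInv rs state → StreamInv [] (streaming rs state)
  streamInv []       state I = I
  streamInv (e ∷ rs) state I = streamInv rs (tryColours (allFin k) e state) (streamInv-step I)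

  -- addTo and push are the same function
  addTo-grows : ∀ M c e → Grows (c ∷ []) e M (addTo M c e)
  addTo-grows M c e = pushedOn (here refl)

  laterColours-sorted : ∀ c → AllPairs _<ᶠ_ (laterColours c)
  laterColours-sorted c = AllPairsₚ.filter⁺ (c <?_) allFin-sorted

  ∈-laterColours⁻ : ∀ {c j} → j ∈ laterColours c → c <ᶠ j
  ∈-laterColours⁻ {c} j∈ = proj₂ (∈-filter⁻ (c <?_) {xs = allFin k} j∈)

  ∈-laterColours⁺ : ∀ {c j} → c <ᶠ j → j ∈ laterColours c
  ∈-laterColours⁺ {c} {j} c<j = ∈-filter⁺ (c <?_) (∈-allFin j) c<j

  touched⇒shareEnd : ∀ {L e} → touched L e ≡ true → ∃[ f ] f ∈ L × shareEnd G e f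
  touched⇒shareEnd {L} {e} touched≡true =
    find (Any.map (λ {f} → T-does⇒ (shareEnd? e f)) (any⁻ (λ f → does (shareEnd? e f)) L (subst T (sym touched≡true) _)))

  untouched⇒¬shareEnd : ∀ {L e} → touched L e ≡ false → ∀ {f} → f ∈ L → ¬ shareEnd G e f
  untouched⇒¬shareEnd {L} {e} touched≡false f∈L sh =
    subst T touched≡false (any⁺ (λ f → does (shareEnd? e f)) (lose f∈L (⇒T-does (shareEnd? e _) sh)))

  InOutput : Matchings → Fin m → Set
  InOutput M e = ∃[ c ] e ∈ M c

  Pending : Fin k → List (Fin m) → Stacks → Fin k → Fin m → Set
  Pending c₀ es S c e = (c ≡ c₀ × e ∈ es) ⊎ (c₀ <ᶠ c × e ∈ S c)

  -- Phase c₀ of the post-processing with es still to be popped; popAll pops from a copy of S c₀,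
  -- so S c₀ itself stays unchanged during the phase.
  record PopInv (c₀ : Fin k) (es : List (Fin m)) (state : Potentials × Stacks × Matchings) : Set where
    φ = proj₁ state
    S = proj₁ (proj₂ state)
    M = proj₂ (proj₂ state)
    field
      consistent          : Consistent φ S
      covered             : ∀ e c → Covered (φ c) e ⊎ InOutput M e ⊎ ∃[ c′ ] c′ <ᶠ c × Pending c₀ es S c′ e
      later-empty         : ∀ c → c₀ <ᶠ c → M c ≡ []
      es-admissible       : Admissible es
      -- once es = [] this is W(c₀) ≤ w(M c₀)
      charge              : reducedTotal (S c₀) + ∑ (endSum (potentialOf es)) (M c₀) ≤ ∑ w (M c₀) + reducedTotal es
      paid                : ∀ c → c <ᶠ c₀ → reducedTotal (S c) ≤ ∑ w (M c)
      es-unique           : Unique es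
      stacks-unique       : ∀ c → c₀ <ᶠ c → Unique (S c)
      matchings           : ∀ c → IsMatching G (M c)
      es#stacks           : ∀ {e} c → c₀ <ᶠ c → e ∈ es → e ∉ S c
      es#matchings        : ∀ {e} c → e ∈ es → e ∉ M c
      stacks#stacks       : ∀ {e} c c′ → c₀ <ᶠ c → c₀ <ᶠ c′ → c ≢ c′ → e ∈ S c → e ∉ S c′
      stacks#matchings    : ∀ {e} c c′ → c₀ <ᶠ c → e ∈ S c → e ∉ M c′
      matchings#matchings : ∀ c c′ → c ≢ c′ → ∀ {e} → e ∈ M c → e ∉ M c′

  popInv-add : ∀ {c₀ e R φ S M} → touched (M c₀) e ≡ false →
               PopInv c₀ (e ∷ R) (φ , S , M) → PopInv c₀ R (φ , S , addTo M c₀ e)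
  popInv-add {c₀} {e} {R} {φ} {S} {M} untouched I = record
    { consistent          = I.consistent
    ; covered             = covered
    ; later-empty         = λ c c₀<c → trans (M′-elsewhere (≢-sym (<ᶠ⇒≢ c₀<c))) (I.later-empty c c₀<c)
    ; es-admissible       = proj₂ I.es-admissible
    ; charge              = charge
    ; paid                = λ c c<c₀ → subst (λ L → _ ≤ ∑ w L) (sym (M′-elsewhere (<ᶠ⇒≢ c<c₀))) (I.paid c c<c₀)
    ; es-unique           = AllPairs.tail I.es-unique
    ; stacks-unique       = I.stacks-unique
    ; matchings           = matchings
    ; es#stacks           = λ c c₀<c x∈R → I.es#stacks c c₀<c (there x∈R)
    ; es#matchings        = es#matchings
    ; stacks#stacks       = I.stacks#stacks
    ; stacks#matchings    = stacks#matchings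
    ; matchings#matchings = matchings#matchings
    }
    where
    module I = PopInv I
    M′ = addTo M c₀ e
    grows = addTo-grows M c₀ e
    M′-elsewhere : ∀ {c} → c ≢ c₀ → M′ c ≡ M c
    M′-elsewhere c≢c₀ = Grows-∉ grows λ { (here c≡c₀) → c≢c₀ c≡c₀ }
    e∉R : e ∉ R
    e∉R = All¬⇒¬Any (AllPairs.head I.es-unique)
    e∈M′ : e ∈ M′ c₀
    e∈M′ = subst (e ∈_) (sym (push-here M c₀ e)) (here refl)
    covered : ∀ e′ c → Covered (φ c) e′ ⊎ InOutput M′ e′ ⊎ ∃[ c′ ] c′ <ᶠ c × Pending c₀ R S c′ e′
    covered e′ c with I.covered e′ c
    ... | inj₁ cov                                  = inj₁ cov
    ... | inj₂ (inj₁ (c′ , e′∈M))                    = inj₂ (inj₁ (c′ , Grows-∈ grows e′∈M))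
    ... | inj₂ (inj₂ (c′ , lt , inj₁ (_ , here refl)))  = inj₂ (inj₁ (c₀ , e∈M′))
    ... | inj₂ (inj₂ (c′ , lt , inj₁ (eq , there e′∈R))) = inj₂ (inj₂ (c′ , lt , inj₁ (eq , e′∈R)))
    ... | inj₂ (inj₂ (c′ , lt , inj₂ pending))      = inj₂ (inj₂ (c′ , lt , inj₂ pending))
    charge : reducedTotal (S c₀) + ∑ (endSum (potentialOf R)) (M′ c₀) ≤ ∑ w (M′ c₀) + reducedTotal R
    charge rewrite push-here M c₀ e = charge-keep (reducedTotal (S c₀)) (M c₀) I.es-admissible I.charge
    matchings : ∀ c → IsMatching G (M′ c)
    matchings c with Grows-shape grows c
    ... | inj₁ M′c≡                = subst (IsMatching G) (sym M′c≡) (I.matchings c)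
    ... | inj₂ (here refl , M′c≡) =
      subst (IsMatching G) (sym M′c≡) (IsMatching-∷ (I.matchings c₀) (untouched⇒¬shareEnd untouched))
    es#matchings : ∀ {x} c → x ∈ R → x ∉ M′ c
    es#matchings c x∈R x∈M′ with Grows-∈⁻ grows x∈M′
    ... | inj₁ (refl , _) = e∉R x∈R
    ... | inj₂ x∈M        = I.es#matchings c (there x∈R) x∈M
    stacks#matchings : ∀ {x} c c′ → c₀ <ᶠ c → x ∈ S c → x ∉ M′ c′
    stacks#matchings c c′ c₀<c x∈S x∈M′ with Grows-∈⁻ grows x∈M′
    ... | inj₁ (refl , _) = I.es#stacks c c₀<c (here refl) x∈S
    ... | inj₂ x∈M        = I.stacks#matchings c c′ c₀<c x∈S x∈M
    matchings#matchings : ∀ c c′ → c ≢ c′ → ∀ {x} → x ∈ M′ c → x ∉ M′ c′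
    matchings#matchings c c′ c≢c′ x∈ x∈′ with Grows-∈⁻ grows x∈ | Grows-∈⁻ grows x∈′
    ... | inj₁ (refl , here refl) | inj₁ (_ , here refl) = c≢c′ refl
    ... | inj₁ (refl , _)         | inj₂ x∈M′           = I.es#matchings c′ (here refl) x∈M′
    ... | inj₂ x∈M                | inj₁ (refl , _)     = I.es#matchings c (here refl) x∈M
    ... | inj₂ x∈M                | inj₂ x∈M′           = I.matchings#matchings c c′ c≢c′ x∈M x∈M′

  popInv-defer : ∀ {c₀ e R φ S M} → touched (M c₀) e ≡ true → PopInv c₀ (e ∷ R) (φ , S , M) →
                 let (φ′ , S′) = tryColours (laterColours c₀) e (φ , S) in PopInv c₀ R (φ′ , S′ , M)
  popInv-defer {c₀} {e} {R} {φ} {S} {M} touched≡true I = record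
    { consistent          = T.consistent
    ; covered             = covered
    ; later-empty         = I.later-empty
    ; es-admissible       = proj₂ I.es-admissible
    ; charge              = charge
    ; paid                = λ c c<c₀ → subst (λ L → reducedTotal L ≤ _) (sym (unchanged-below c<c₀)) (I.paid c c<c₀)
    ; es-unique           = AllPairs.tail I.es-unique
    ; stacks-unique       = λ c c₀<c → Grows-unique T.grows (I.stacks-unique c c₀<c) (I.es#stacks c c₀<c (here refl))
    ; matchings           = I.matchings
    ; es#stacks           = es#stacks
    ; es#matchings        = λ c x∈R → I.es#matchings c (there x∈R)
    ; stacks#stacks       = stacks#stacks
    ; stacks#matchings    = stacks#matchings
    ; matchings#matchings = I.matchings#matchings
    }
    where
    module I = PopInv I
    module T = TrySpec (trySpec (laterColours c₀) (laterColours-sorted c₀) e I.consistent)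
    e∉R : e ∉ R
    e∉R = All¬⇒¬Any (AllPairs.head I.es-unique)
    unchanged-below : ∀ {c} → c <ᶠ c₀ → T.S′ c ≡ S c
    unchanged-below c<c₀ = Grows-∉ T.grows (λ c∈ → <ᶠ-asym c<c₀ (∈-laterColours⁻ c∈))
    covered : ∀ e′ c → Covered (T.φ′ c) e′ ⊎ InOutput M e′ ⊎ ∃[ c′ ] c′ <ᶠ c × Pending c₀ R T.S′ c′ e′
    covered e′ c with I.covered e′ c
    ... | inj₁ cov = inj₁ (Covered-mono (T.monotone c) cov)
    ... | inj₂ (inj₁ output) = inj₂ (inj₁ output)
    ... | inj₂ (inj₂ (c′ , c′<c , inj₁ (refl , here refl))) with T.covered (∈-laterColours⁺ c′<c)
    ...   | inj₁ cov                    = inj₁ cov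
    ...   | inj₂ (j , j<c , j∈ , e∈S′j) = inj₂ (inj₂ (j , j<c , inj₂ (∈-laterColours⁻ j∈ , e∈S′j)))
    covered e′ c | inj₂ (inj₂ (c′ , c′<c , inj₁ (c′≡c₀ , there e′∈R))) =
      inj₂ (inj₂ (c′ , c′<c , inj₁ (c′≡c₀ , e′∈R)))
    covered e′ c | inj₂ (inj₂ (c′ , c′<c , inj₂ (c₀<c′ , e′∈S))) =
      inj₂ (inj₂ (c′ , c′<c , inj₂ (c₀<c′ , Grows-∈ T.grows e′∈S)))
    charge : reducedTotal (T.S′ c₀) + ∑ (endSum (potentialOf R)) (M c₀) ≤ ∑ w (M c₀) + reducedTotal R
    charge rewrite Grows-∉ T.grows (λ c₀∈ → <ᶠ-irrefl refl (∈-laterColours⁻ c₀∈)) =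
      let (f , f∈M , shares) = touched⇒shareEnd touched≡true in
      charge-skip (reducedTotal (S c₀)) (M c₀) I.es-admissible I.charge f∈M shares
    es#stacks : ∀ {x} c → c₀ <ᶠ c → x ∈ R → x ∉ T.S′ c
    es#stacks c c₀<c x∈R x∈S′ with Grows-∈⁻ T.grows x∈S′
    ... | inj₁ (refl , _) = e∉R x∈R
    ... | inj₂ x∈S        = I.es#stacks c c₀<c (there x∈R) x∈S
    stacks#stacks : ∀ {x} c c′ → c₀ <ᶠ c → c₀ <ᶠ c′ → c ≢ c′ → x ∈ T.S′ c → x ∉ T.S′ c′
    stacks#stacks c c′ c₀<c c₀<c′ c≢c′ x∈ x∈′ with Grows-∈⁻ T.grows x∈ | Grows-∈⁻ T.grows x∈′
    ... | inj₁ (refl , _) | inj₁ _          =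
      c≢c′ (Grows-once T.grows x∈ x∈′ (I.es#stacks c c₀<c (here refl)) (I.es#stacks c′ c₀<c′ (here refl)))
    ... | inj₁ (refl , _) | inj₂ x∈′S       = I.es#stacks c′ c₀<c′ (here refl) x∈′S
    ... | inj₂ x∈S        | inj₁ (refl , _) = I.es#stacks c c₀<c (here refl) x∈S
    ... | inj₂ x∈S        | inj₂ x∈′S       = I.stacks#stacks c c′ c₀<c c₀<c′ c≢c′ x∈S x∈′S
    stacks#matchings : ∀ {x} c c′ → c₀ <ᶠ c → x ∈ T.S′ c → x ∉ M c′
    stacks#matchings c c′ c₀<c x∈S′ x∈M with Grows-∈⁻ T.grows x∈S′
    ... | inj₁ (refl , _) = I.es#matchings c′ (here refl) x∈M
    ... | inj₂ x∈S        = I.stacks#matchings c c′ c₀<c x∈S x∈M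

  popInv : ∀ c₀ es state → PopInv c₀ es state → PopInv c₀ [] (popAll c₀ es state)
  popInv c₀ []      state       I = I
  popInv c₀ (e ∷ R) (φ , S , M) I = by-touch (touched (M c₀) e) refl
    where
    by-touch : (b : Bool) → touched (M c₀) e ≡ b →
               PopInv c₀ [] (if b then popAll c₀ R (let (φ′ , S′) = tryColours (laterColours c₀) e (φ , S)
                                                    in (φ′ , S′ , M))
                                  else popAll c₀ R (φ , S , addTo M c₀ e))
    by-touch true  touched≡true  = popInv c₀ R _ (popInv-defer touched≡true I)
    by-touch false touched≡false = popInv c₀ R _ (popInv-add touched≡false I)

  p+0≤0+p : ∀ p → p + 0ℚ ≤ 0ℚ + p
  p+0≤0+p p = ≤-reflexive (trans (+-identityʳ p) (sym (+-identityˡ p)))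

  popInv-paid : ∀ {c₀ φ S M} → PopInv c₀ [] (φ , S , M) → reducedTotal (S c₀) ≤ ∑ w (M c₀)
  popInv-paid {c₀} {φ} {S} {M} I = begin
    reducedTotal (S c₀)                               ≡⟨ +-identityʳ _ ⟨
    reducedTotal (S c₀) + 0ℚ                          ≡⟨ cong (reducedTotal (S c₀) +_) (∑-zero (M c₀)) ⟨
    reducedTotal (S c₀) + ∑ (endSum (potentialOf [])) (M c₀) ≤⟨ PopInv.charge I ⟩
    ∑ w (M c₀) + 0ℚ                                   ≡⟨ +-identityʳ _ ⟩
    ∑ w (M c₀)                                        ∎
    where open ≤-Reasoning

  popInv-next : ∀ {c₀ c₁ φ S M} → PopInv c₀ [] (φ , S , M) →
                c₀ <ᶠ c₁ → (∀ {j} → c₀ <ᶠ j → j ≡ c₁ ⊎ c₁ <ᶠ j) →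
                PopInv c₁ (S c₁) (φ , S , M)
  popInv-next {c₀} {c₁} {φ} {S} {M} I c₀<c₁ next = record
    { consistent          = I.consistent
    ; covered             = covered
    ; later-empty         = λ c c₁<c → I.later-empty c (<ᶠ-trans c₀<c₁ c₁<c)
    ; es-admissible       = proj₂ (I.consistent c₁)
    ; charge              = subst (λ L → W₁ + ∑ (endSum (potentialOf (S c₁))) L ≤ ∑ w L + W₁)
                                  (sym (I.later-empty c₁ c₀<c₁)) (p+0≤0+p W₁)
    ; paid                = paid
    ; es-unique           = I.stacks-unique c₁ c₀<c₁
    ; stacks-unique       = λ c c₁<c → I.stacks-unique c (<ᶠ-trans c₀<c₁ c₁<c)
    ; matchings           = I.matchings
    ; es#stacks           = λ c c₁<c → I.stacks#stacks c₁ c c₀<c₁ (<ᶠ-trans c₀<c₁ c₁<c) (<ᶠ⇒≢ c₁<c)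
    ; es#matchings        = λ c → I.stacks#matchings c₁ c c₀<c₁
    ; stacks#stacks       = λ c c′ c₁<c c₁<c′ →
                              I.stacks#stacks c c′ (<ᶠ-trans c₀<c₁ c₁<c) (<ᶠ-trans c₀<c₁ c₁<c′)
    ; stacks#matchings    = λ c c′ c₁<c → I.stacks#matchings c c′ (<ᶠ-trans c₀<c₁ c₁<c)
    ; matchings#matchings = I.matchings#matchings
    }
    where
    module I = PopInv I
    W₁ = reducedTotal (S c₁)
    covered : ∀ e c → Covered (φ c) e ⊎ InOutput M e ⊎ ∃[ c′ ] c′ <ᶠ c × Pending c₁ (S c₁) S c′ e
    covered e c with I.covered e c
    ... | inj₁ cov                               = inj₁ cov
    ... | inj₂ (inj₁ output)                     = inj₂ (inj₁ output)
    ... | inj₂ (inj₂ (c′ , c′<c , inj₂ (c₀<c′ , e∈S))) with next c₀<c′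
    ...   | inj₁ refl   = inj₂ (inj₂ (c′ , c′<c , inj₁ (refl , e∈S)))
    ...   | inj₂ c₁<c′  = inj₂ (inj₂ (c′ , c′<c , inj₂ (c₁<c′ , e∈S)))
    paid : ∀ c → c <ᶠ c₁ → reducedTotal (S c) ≤ ∑ w (M c)
    paid c c<c₁ with <ᶠ-cmp c c₀
    ... | tri< c<c₀ _ _ = I.paid c c<c₀
    ... | tri≈ _ refl _ = popInv-paid I
    ... | tri> _ _ c₀<c with next c₀<c
    ...   | inj₁ refl  = ⊥-elim (<ᶠ-irrefl refl c<c₁)
    ...   | inj₂ c₁<c  = ⊥-elim (<ᶠ-asym c<c₁ c₁<c)

  record Final (state : Potentials × Stacks × Matchings) : Set where
    φ = proj₁ state
    S = proj₁ (proj₂ state)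
    M = proj₂ (proj₂ state)
    field
      consistent : Consistent φ S
      covered    : ∀ e c → Covered (φ c) e ⊎ InOutput M e
      paid       : ∀ c → reducedTotal (S c) ≤ ∑ w (M c)
      disjoint   : IsKDisjointMatching G k M

  popInv-final : ∀ {c₀ φ S M} → PopInv c₀ [] (φ , S , M) → (∀ {j} → ¬ c₀ <ᶠ j) → Final (φ , S , M)
  popInv-final {c₀} I last = record
    { consistent = I.consistent
    ; covered    = covered
    ; paid       = paid
    ; disjoint   = I.matchings , I.matchings#matchings
    }
    where
    module I = PopInv I
    covered : ∀ e c → Covered (I.φ c) e ⊎ InOutput I.M e
    covered e c with I.covered e c
    ... | inj₁ cov                                  = inj₁ cov
    ... | inj₂ (inj₁ output)                        = inj₂ output
    ... | inj₂ (inj₂ (_ , _ , inj₂ (c₀<c′ , _)))   = ⊥-elim (last c₀<c′)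
    paid : ∀ c → reducedTotal (I.S c) ≤ ∑ w (I.M c)
    paid c with <ᶠ-cmp c c₀
    ... | tri< c<c₀ _ _ = I.paid c c<c₀
    ... | tri≈ _ refl _ = popInv-paid I
    ... | tri> _ _ c₀<c = ⊥-elim (last c₀<c)

  popInv-start : ∀ {φ S} → StreamInv [] (φ , S) → PopInv zero (S zero) (φ , S , λ _ → [])
  popInv-start {φ} {S} I = record
    { consistent          = I.consistent
    ; covered             = covered
    ; later-empty         = λ _ _ → refl
    ; es-admissible       = proj₂ (I.consistent zero)
    ; charge              = p+0≤0+p (reducedTotal (S zero))
    ; paid                = λ _ ()
    ; es-unique           = I.stacks-unique zero
    ; stacks-unique       = λ c _ → I.stacks-unique c
    ; matchings           = λ _ → [] , λ ()
    ; es#stacks           = λ c 0<c → I.stacks#stacks zero c (<ᶠ⇒≢ 0<c)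
    ; es#matchings        = λ _ _ ()
    ; stacks#stacks       = λ c c′ _ _ → I.stacks#stacks c c′
    ; stacks#matchings    = λ _ _ _ _ ()
    ; matchings#matchings = λ _ _ _ ()
    }
    where
    module I = StreamInv I
    covered : ∀ e c → Covered (φ c) e ⊎ InOutput (λ _ → []) e ⊎ ∃[ c′ ] c′ <ᶠ c × Pending zero (S zero) S c′ e
    covered e c with I.covered e
    ... | inj₂ done with done c
    ...   | inj₁ cov                    = inj₁ cov
    ...   | inj₂ (zero   , c′<c , e∈S) = inj₂ (inj₂ (zero , c′<c , inj₁ (refl , e∈S)))
    ...   | inj₂ (suc c′ , c′<c , e∈S) = inj₂ (inj₂ (suc c′ , c′<c , inj₂ (z<s , e∈S)))

  postProcessInv : ∀ c₀ cs state → AllPairs _<ᶠ_ (c₀ ∷ cs) → (∀ {j} → c₀ <ᶠ j → j ∈ cs) →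
                   PopInv c₀ (proj₁ (proj₂ state) c₀) state → Final (postProcess (c₀ ∷ cs) state)
  afterPhaseInv : ∀ c₀ cs state → AllPairs _<ᶠ_ (c₀ ∷ cs) → (∀ {j} → c₀ <ᶠ j → j ∈ cs) →
                  PopInv c₀ [] state → Final (postProcess cs state)

  postProcessInv c₀ cs (φ , S , M) sorted later∈cs I =
    afterPhaseInv c₀ cs (popAll c₀ (S c₀) (φ , S , M)) sorted later∈cs (popInv c₀ (S c₀) _ I)

  afterPhaseInv c₀ []        (φ , S , M) _ later∈cs I = popInv-final I (λ c₀<j → case later∈cs c₀<j of λ ())
  afterPhaseInv c₀ (c₁ ∷ cs) (φ , S , M) ((c₀<c₁ ∷ c₀<cs) ∷ sorted) later∈cs I =
    postProcessInv c₁ cs (φ , S , M) sorted later∈cs′ (popInv-next I c₀<c₁ next)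
    where
    next : ∀ {j} → c₀ <ᶠ j → j ≡ c₁ ⊎ c₁ <ᶠ j
    next c₀<j with later∈cs c₀<j
    ... | here j≡c₁  = inj₁ j≡c₁
    ... | there j∈cs = inj₂ (All.lookup (AllPairs.head sorted) j∈cs)
    later∈cs′ : ∀ {j} → c₁ <ᶠ j → j ∈ cs
    later∈cs′ c₁<j with later∈cs (<ᶠ-trans c₀<c₁ c₁<j)
    ... | here refl  = ⊥-elim (<ᶠ-irrefl refl c₁<j)
    ... | there j∈cs = j∈cs

  streamInv-initial : ∀ {order} → order ↭ allFin m → StreamInv order initial
  streamInv-initial order↭ = record
    { consistent    = λ _ → (λ _ → refl) , _
    ; covered       = λ e → inj₁ (∈-resp-↭ (↭-sym order↭) (∈-allFin e))
    ; rs-unique     = Unique-resp-↭ (setoid (Fin m)) (↭⇒↭ₛ (↭-sym order↭)) (allFin⁺ m)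
    ; stacks-unique = λ _ → []
    ; rs#stacks     = λ _ _ ()
    ; stacks#stacks = λ _ _ _ ()
    }

  final : ∀ {order} → order ↭ allFin m →
          Final (postProcess (allFin k) (proj₁ (streaming order initial) , proj₂ (streaming order initial) , λ _ → []))
  final {order} order↭ =
    postProcessInv zero _ _ allFin-sorted (λ { {suc j} _ → ∈-tabulate⁺ j })
      (popInv-start (streamInv order initial (streamInv-initial order↭)))

  open import Data.List.Membership.DecPropositional (_≟ᶠ_ {m}) using (_∈?_)

  wAt : Fin m → Fin m → ℚ
  wAt x e = if does (e ≟ᶠ x) then w e else 0ℚ

  wIn : List (Fin m) → Fin m → ℚ
  wIn L e = if does (e ∈? L) then w e else 0ℚ

  0≤w : ∀ e → 0ℚ ≤ w e
  0≤w e = <⇒≤ (positive e)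

  0≤wIn : ∀ L e → 0ℚ ≤ wIn L e
  0≤wIn L e with does (e ∈? L)
  ... | true  = 0≤w e
  ... | false = ≤-refl

  wIn-∈ : ∀ {L e} → e ∈ L → wIn L e ≡ w e
  wIn-∈ {L} {e} e∈L = if-true (dec-true (e ∈? L) e∈L)

  ∑-wAt : ∀ x {Y} → Unique Y → ∑ (wAt x) Y ≤ w x
  ∑-wAt x {[]}    _              = 0≤w x
  ∑-wAt x {y ∷ Y} (y∉Y ∷ unique) with y ≟ᶠ x
  ... | yes refl = ≤-reflexive (begin
    w y + ∑ (wAt y) Y
      ≡⟨ cong (w y +_) (∑-cong Y (λ e∈Y → if-false (dec-false (_ ≟ᶠ y) (All.lookup y∉Y e∈Y ∘ sym)))) ⟩
    w y + ∑ (λ _ → 0ℚ) Y      ≡⟨ cong (w y +_) (∑-zero Y) ⟩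
    w y + 0ℚ                  ≡⟨ +-identityʳ (w y) ⟩
    w y                       ∎)
    where open ≡-Reasoning
  ... | no _ = subst (_≤ w x) (sym (+-identityˡ _)) (∑-wAt x unique)

  ∑-wIn : ∀ L {Y} → Unique Y → ∑ (wIn L) Y ≤ ∑ w L
  ∑-wIn []      {Y} _      = ≤-reflexive (∑-zero Y)
  ∑-wIn (x ∷ L) {Y} unique = begin
    ∑ (wIn (x ∷ L)) Y                  ≤⟨ ∑-mono Y (λ {e} _ → if-∨≤ (does (e ≟ᶠ x)) (does (e ∈? L)) (0≤w e)) ⟩
    ∑ (λ e → wAt x e + wIn L e) Y      ≡⟨ ∑-+ (wAt x) (wIn L) Y ⟩
    ∑ (wAt x) Y + ∑ (wIn L) Y          ≤⟨ +-mono-≤ (∑-wAt x unique) (∑-wIn L unique) ⟩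
    w x + ∑ w L                        ∎
    where open ≤-Reasoning

  outputEdges : Matchings → List (Fin m)
  outputEdges M = concatMap M (allFin k)

  module _ {state} (F : Final state) where
    open Final F

    w≤[1+ε]*endSum+wIn : ∀ c e → w e ≤ (1ℚ + ε) * endSum (φ c) e + wIn (outputEdges M) e
    w≤[1+ε]*endSum+wIn c e with covered e c
    ... | inj₁ cov        = ≤-trans cov (p≤p+q (0≤wIn (outputEdges M) e))
    ... | inj₂ (c′ , e∈M) = begin
      w e
        ≡⟨ +-identityˡ (w e) ⟨
      0ℚ + w e
        ≤⟨ +-monoˡ-≤ (w e) (0≤p*q 0≤1+ε (0≤endSum (consistent-nonNeg consistent c) e)) ⟩
      (1ℚ + ε) * endSum (φ c) e + w e
        ≡⟨ cong ((1ℚ + ε) * endSum (φ c) e +_) (wIn-∈ (∈-concatMap⁺ M (lose (∈-allFin c′) e∈M))) ⟨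
      (1ℚ + ε) * endSum (φ c) e + wIn (outputEdges M) e
        ∎
      where open ≤-Reasoning

    ∑-w-colour : ∀ c {N} → IsMatching G N →
                 ∑ w N ≤ ((1ℚ + ε) * (1ℚ + 1ℚ)) * ∑ w (M c) + ∑ (wIn (outputEdges M)) N
    ∑-w-colour c {N} N-matching = begin
      ∑ w N
        ≤⟨ ∑-mono N (λ {e} _ → w≤[1+ε]*endSum+wIn c e) ⟩
      ∑ (λ e → (1ℚ + ε) * endSum (φ c) e + wIn L e) N
        ≡⟨ ∑-+ _ (wIn L) N ⟩
      ∑ (λ e → (1ℚ + ε) * endSum (φ c) e) N + ∑ (wIn L) N
        ≡⟨ cong (_+ ∑ (wIn L) N) (∑-* (1ℚ + ε) (endSum (φ c)) N) ⟩
      (1ℚ + ε) * ∑ (endSum (φ c)) N + ∑ (wIn L) N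
        ≡⟨ cong (λ s → (1ℚ + ε) * s + ∑ (wIn L) N) (∑-cong N (λ _ → endSum-cong (proj₁ (consistent c)) _)) ⟩
      (1ℚ + ε) * ∑ (endSum (potentialOf (S c))) N + ∑ (wIn L) N
        ≤⟨ +-monoˡ-≤ (∑ (wIn L) N) (*-monoʳ-≤-0≤ 0≤1+ε (begin
             ∑ (endSum (potentialOf (S c))) N   ≤⟨ ∑-endSum-potentialOf (S c) (proj₂ (consistent c)) N-matching ⟩
             (1ℚ + 1ℚ) * reducedTotal (S c)     ≤⟨ *-monoʳ-≤-0≤ (nonNegative⁻¹ (1ℚ + 1ℚ)) (paid c) ⟩
             (1ℚ + 1ℚ) * ∑ w (M c)              ∎)) ⟩
      (1ℚ + ε) * ((1ℚ + 1ℚ) * ∑ w (M c)) + ∑ (wIn L) N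
        ≡⟨ cong (_+ ∑ (wIn L) N) (*-assoc (1ℚ + ε) (1ℚ + 1ℚ) (∑ w (M c))) ⟨
      ((1ℚ + ε) * (1ℚ + 1ℚ)) * ∑ w (M c) + ∑ (wIn L) N ∎
      where
      open ≤-Reasoning
      L = outputEdges M

    weight-bound : ∀ M* → IsKDisjointMatching G k M* →
                   weight G M* ≤ ((1ℚ + 1ℚ + 1ℚ) + (1ℚ + 1ℚ) * ε) * weight G M
    weight-bound M* (M*-matchings , M*-disjoint) = begin
      ∑ (λ c → ∑ w (M* c)) cs
        ≤⟨ ∑-mono cs (λ {c} _ → ∑-w-colour c (M*-matchings c)) ⟩
      ∑ (λ c → a * ∑ w (M c) + ∑ (wIn L) (M* c)) cs
        ≡⟨ ∑-+ (λ c → a * ∑ w (M c)) (λ c → ∑ (wIn L) (M* c)) cs ⟩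
      ∑ (λ c → a * ∑ w (M c)) cs + ∑ (λ c → ∑ (wIn L) (M* c)) cs
        ≡⟨ cong₂ _+_ (sym (∑-* a (λ c → ∑ w (M c)) cs)) (∑-concatMap (wIn L) M* cs) ⟨
      a * W + ∑ (wIn L) (concatMap M* cs)
        ≤⟨ +-monoʳ-≤ (a * W) (∑-wIn L (Unique-concatMap M* (allFin⁺ k) (proj₁ ∘ M*-matchings) M*-disjoint)) ⟩
      a * W + ∑ w L
        ≡⟨ cong (a * W +_) (∑-concatMap w M cs) ⟩
      a * W + W
        ≡⟨ collect ε W ⟩
      ((1ℚ + 1ℚ + 1ℚ) + (1ℚ + 1ℚ) * ε) * W ∎
      where
      open ≤-Reasoning
      cs = allFin k
      L = outputEdges M
      a = (1ℚ + ε) * (1ℚ + 1ℚ)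
      W = weight G M
      collect : ∀ ε W → ((1ℚ + ε) * (1ℚ + 1ℚ)) * W + W ≡ ((1ℚ + 1ℚ + 1ℚ) + (1ℚ + 1ℚ) * ε) * W
      collect = solve-∀ ringℚ

mainTheorem4 : ∀ (ε : ℚ) → 0ℚ < ε → (k : ℕ) → k ≥ 1 →
    ∀ {n m} (G : Graph n m) (order : List (Fin m)) → order ↭ allFin m →
    IsKDisjointMatching G k (STK G k ε order)
    × (∀ (M* : Fin k → List (Fin m)) → IsKDisjointMatching G k M* →
         weight G M* ≤ ((1ℚ + 1ℚ + 1ℚ) + (1ℚ + 1ℚ) * ε) * weight G (STK G k ε order))
mainTheorem4 ε 0<ε (suc k′) _ G order order↭ = Final.disjoint F , weight-bound F
  where
  open Analysis G k′ ε 0<ε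
  F = final order↭
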